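{- Let $T$ be a recursively bridge-mirrored tree, and let $(A_1,u_1)$ and $(A_2,u_2)$ be two branches of $T$. (a) If $|A_1|=|A_2|\le|T|/2$, then $(A_1,u_1)$ and $(A_2,u_2)$ are isomorphic as rooted trees. (b) If $|T|/4<|A_1|=|A_2|\le|T|/2$, then $T$ has an automorphism carrying $(A_1,u_1)$ to $(A_2,u_2)$.
   Context: All graphs are undirected; $|G|$ is the number of vertices of $G$. A tree is recursively bridge-mirrored if it can be built by: (i) the one-vertex tree is; (ii) if $T$ is, choose a root vertex, take two identical copies of the rooted tree and join the two roots by an edge. For an edge $uv$ of a tree $T$, the branch of $T$ cut from $uv$ is the rooted tree $(B,v)$ where $B$ is the component of $T\setminus uv$ (the edge $uv$ removed) containing $v$. -}

module Defs where

open import Data.Nat using (ℕ; _+_)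
open import Data.Bool using (Bool; true; false; _∧_)
open import Data.Fin using (Fin; zero; splitAt)
open import Data.Fin.Properties using (_≟_)
open import Data.Fin.Subset using (Subset; _∈_)
open import Data.Fin.Permutation using (Permutation′; _⟨$⟩ʳ_)
open import Data.Sum using (_⊎_; inj₁; inj₂)
open import Data.Product using (Σ; _×_; _,_)
open import Relation.Nullary using (¬_; does)
open import Relation.Binary.PropositionalEquality using (_≡_)
open import Relation.Binary.Construct.Closure.ReflexiveTransitive using (Star)

-- A (simple, undirected) graph on the vertex set Fin n, given by a Boolean
-- adjacency matrix.  For all graphs built below it is symmetric and irreflexive.
Graph : ℕ → Set
Graph n = Fin n → Fin n → Bool

Adj : ∀ {n} → Graph n → Fin n → Fin n → Set
Adj G x y = G x y ≡ true

Iso : ∀ {n} → Graph n → Graph n → Set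
Iso {n} G H = Σ (Permutation′ n) λ σ → ∀ x y → H (σ ⟨$⟩ʳ x) (σ ⟨$⟩ʳ y) ≡ G x y

single : Graph 1
single _ _ = false

-- Two copies of the tree G rooted at r, on Fin (n + n) (first copy = first
-- n vertices, second copy = last n vertices), roots joined by an edge.
mirror : ∀ {n} → Graph n → Fin n → Graph (n + n)
mirror {n} G r x y with splitAt n x | splitAt n y
... | inj₁ a | inj₁ b = G a b
... | inj₂ a | inj₂ b = G a b
... | inj₁ a | inj₂ b = does (a ≟ r) ∧ does (b ≟ r)
... | inj₂ a | inj₁ b = does (a ≟ r) ∧ does (b ≟ r)

data Mirrored : (n : ℕ) → Graph n → Set where
  base : Mirrored 1 single
  step : ∀ {n} {G : Graph n} → Mirrored n G → (r : Fin n) →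
         Mirrored (n + n) (mirror G r)

-- T is recursively bridge-mirrored: it is isomorphic to a tree built by the
-- construction (trees are considered up to isomorphism).
RBM : ∀ {n} → Graph n → Set
RBM {n} T = Σ (Graph n) λ G → Mirrored n G × Iso G T

AdjMinus : ∀ {n} → Graph n → Fin n → Fin n → Fin n → Fin n → Set
AdjMinus T w u x y =
  Adj T x y × ¬ ((x ≡ w × y ≡ u) ⊎ (x ≡ u × y ≡ w))

InBranch : ∀ {n} → Graph n → Fin n → Fin n → Fin n → Set
InBranch T w u x = Star (AdjMinus T w u) u x

IsBranch : ∀ {n} → Graph n → Fin n → Fin n → Subset n → Set
IsBranch T w u A = Adj T w u × (∀ x → (x ∈ A → InBranch T w u x) × (InBranch T w u x → x ∈ A))

RootedIso : ∀ {n} → Graph n → Subset n → Fin n → Subset n → Fin n → Set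
RootedIso {n} T A₁ u₁ A₂ u₂ = Σ (Fin n → Fin n) λ f →
    (∀ x → x ∈ A₁ → f x ∈ A₂)
  × (∀ x y → x ∈ A₁ → y ∈ A₁ → f x ≡ f y → x ≡ y)
  × (∀ y → y ∈ A₂ → Σ (Fin n) λ x → x ∈ A₁ × f x ≡ y)
  × (∀ x y → x ∈ A₁ → y ∈ A₁ → T (f x) (f y) ≡ T x y)
  × f u₁ ≡ u₂

AutCarrying : ∀ {n} → Graph n → Subset n → Fin n → Subset n → Fin n → Set
AutCarrying {n} T A₁ u₁ A₂ u₂ = Σ (Permutation′ n) λ σ →
    (∀ x y → T (σ ⟨$⟩ʳ x) (σ ⟨$⟩ʳ y) ≡ T x y)
  × (∀ x → (x ∈ A₁ → (σ ⟨$⟩ʳ x) ∈ A₂) × ((σ ⟨$⟩ʳ x) ∈ A₂ → x ∈ A₁))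
  × σ ⟨$⟩ʳ u₁ ≡ u₂

module Submission where

-- In T = mirror H q the vertex set is
-- two copies of H joined by the bridge between the copies of q, and every
-- branch of T has one of three shapes: a whole copy (cut from the bridge),
-- the copy of a branch B of H with q ∉ B ("within"), or such a copy together
-- with the whole other copy when q ∈ B ("beyond").  These have fewer than,
-- exactly, and more than |H| vertices respectively, so equal branches have
-- equal shape and branches of size at most |T|/2 are never beyond-branches.
--
-- Along the construction we carry connectivity and two invariants: two
-- branches sharing a vertex and jointly avoiding a vertex are cut from the
-- same edge or strictly nested (Nesting), and equal-size branches jointly
-- avoiding a vertex are isomorphic (AvoidingIso).  Two whole copies are
-- exchanged by the identity or the swap of the copies; two within-branches
-- avoid q in H, so AvoidingIso for H gives (a); if they exceed a quarter of
-- T they meet in H, Nesting for H puts them on the same edge of H, and again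
-- the identity or the swap gives (b).  The result is finally transported
-- along the isomorphism between T and a tree built by the construction.

open import Defs
open import Function using (_∘_; id)
open import Data.Nat using (ℕ; suc; _+_; _*_; _≤_; _<_; z≤n; s≤s)
open import Data.Nat.Properties
  using (≤-trans; ≤-antisym; <-irrefl; <-asym; <⇒≱; ≰⇒>; m≤n⇒m≤1+n; +-suc; +-identityʳ; +-mono-≤; +-mono-<)
open import Data.Nat.Tactic.RingSolver using (solve-∀)
open import Data.Bool using (Bool; true; false; not; _∧_)
open import Data.Bool.Properties using (not-involutive; not-injective; not-¬; ¬-not)
open import Data.Fin using (Fin; zero; suc; splitAt; _↑ˡ_; _↑ʳ_; join)
open import Data.Fin.Properties using (_≟_; splitAt-↑ˡ; splitAt-↑ʳ; join-splitAt; suc-injective; 0≢1+n; any?)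
open import Data.Fin.Subset using (Subset; ∣_∣; _∈_; _∉_; _-_; ⊤; _⊆_; _⊂_; inside; outside)
open import Data.Fin.Subset.Properties
  using (_∈?_; ∈⊤; ∣⊤∣≡n; ⊆-antisym; p⊂q⇒∣p∣<∣q∣; x∈p∧x≢y⇒x∈p-y; x∈p⇒∣p-x∣<∣p∣)
open import Data.Fin.Permutation as Perm using (Permutation′; _⟨$⟩ʳ_; _⟨$⟩ˡ_; permutation; inverseˡ; inverseʳ; _∘ₚ_)
open import Data.Vec using ([]; _∷_; here; there; tabulate; lookup)
open import Data.Vec.Properties using ([]=⇒lookup; lookup⇒[]=; lookup∘tabulate)
open import Data.Sum using (_⊎_; inj₁; inj₂)
open import Data.Product using (Σ; _×_; _,_; proj₁; proj₂)
open import Data.Empty using (⊥; ⊥-elim)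
open import Relation.Nullary using (¬_; Dec; yes; no; does)
open import Relation.Nullary.Decidable using (dec-true; _×-dec_)
open import Relation.Binary.PropositionalEquality
  using (_≡_; _≢_; refl; sym; trans; cong; cong₂; subst; subst₂; module ≡-Reasoning)
open import Relation.Binary.Construct.Closure.ReflexiveTransitive using (Star; ε; _◅_; _◅◅_; gmap; fold)

too-large : ∀ {N m} → N < m → 2 * m ≤ N + N → ⊥
too-large {N} {m} N<m small =
  <⇒≱ (+-mono-< N<m N<m) (subst (_≤ N + N) (cong (m +_) (+-identityʳ m)) small)

more-than-quarter : ∀ {N m} → N + N < 4 * m → N < m + m
more-than-quarter {N} {m} big =
  ≰⇒> λ m+m≤N → <⇒≱ big (subst (_≤ N + N) (sym (four m)) (+-mono-≤ m+m≤N m+m≤N))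
  where
  four : ∀ m → 4 * m ≡ (m + m) + (m + m)
  four = solve-∀

card-≤ : ∀ {n m} (A : Subset n) (B : Subset m) (f : Fin n → Fin m) →
  (∀ x → x ∈ A → f x ∈ B) → (∀ x y → x ∈ A → y ∈ A → f x ≡ f y → x ≡ y) → ∣ A ∣ ≤ ∣ B ∣
card-≤ [] B f maps inj = z≤n
card-≤ (outside ∷ A) B f maps inj =
  card-≤ A B (λ x → f (suc x)) (λ x m → maps (suc x) (there m))
    (λ x y mx my e → suc-injective (inj (suc x) (suc y) (there mx) (there my) e))
card-≤ (inside ∷ A) B f maps inj = ≤-trans (s≤s rest) (x∈p⇒∣p-x∣<∣p∣ (maps zero here))
  where
  rest : ∣ A ∣ ≤ ∣ B - f zero ∣
  rest = card-≤ A (B - f zero) (λ x → f (suc x))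
    (λ x m → x∈p∧x≢y⇒x∈p-y (maps (suc x) (there m)) (λ e → 0≢1+n (inj zero (suc x) here (there m) (sym e))))
    (λ x y mx my e → suc-injective (inj (suc x) (suc y) (there mx) (there my) e))

card-< : ∀ {n m} (A : Subset n) (B : Subset m) (f : Fin n → Fin m) →
  (∀ x → x ∈ A → f x ∈ B) → (∀ x y → x ∈ A → y ∈ A → f x ≡ f y → x ≡ y) →
  (b : Fin m) → b ∈ B → (∀ x → x ∈ A → f x ≢ b) → ∣ A ∣ < ∣ B ∣
card-< A B f maps inj b b∈B misses =
  ≤-trans (s≤s (card-≤ A (B - b) f (λ x m → x∈p∧x≢y⇒x∈p-y (maps x m) (misses x m)) inj)) (x∈p⇒∣p-x∣<∣p∣ b∈B)

missing⇒card< : ∀ {n} {B : Subset n} {x} → x ∉ B → ∣ B ∣ < n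
missing⇒card< {n} {B} {x} x∉B =
  subst (∣ B ∣ <_) (∣⊤∣≡n n)
    (card-< B ⊤ id (λ _ _ → ∈⊤) (λ _ _ _ _ e → e) x ∈⊤ (λ y y∈B e → x∉B (subst (_∈ B) e y∈B)))

disjoint-card : ∀ {n} (A B : Subset n) → (∀ x → x ∈ A → x ∈ B → ⊥) → ∣ A ∣ + ∣ B ∣ ≤ n
disjoint-card [] [] _ = z≤n
disjoint-card (outside ∷ A) (outside ∷ B) disj =
  m≤n⇒m≤1+n (disjoint-card A B (λ x a b → disj (suc x) (there a) (there b)))
disjoint-card {suc n} (outside ∷ A) (inside ∷ B) disj =
  subst (_≤ suc n) (sym (+-suc ∣ A ∣ ∣ B ∣)) (s≤s (disjoint-card A B (λ x a b → disj (suc x) (there a) (there b))))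
disjoint-card (inside ∷ A) (outside ∷ B) disj = s≤s (disjoint-card A B (λ x a b → disj (suc x) (there a) (there b)))
disjoint-card (inside ∷ A) (inside ∷ B) disj = ⊥-elim (disj zero here here)

pigeonhole : ∀ {n} (A B : Subset n) → n < ∣ A ∣ + ∣ B ∣ → Σ (Fin n) λ x → x ∈ A × x ∈ B
pigeonhole A B big with any? (λ x → x ∈? A ×-dec x ∈? B)
... | yes common = common
... | no disjoint = ⊥-elim (<⇒≱ big (disjoint-card A B (λ x a b → disjoint (x , a , b))))

preimage : ∀ {m n} → (Fin m → Fin n) → Subset n → Subset m
preimage f A = tabulate (λ x → lookup A (f x))

∈-preimage⁻ : ∀ {m n} (f : Fin m → Fin n) A x → x ∈ preimage f A → f x ∈ A
∈-preimage⁻ f A x m =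
  lookup⇒[]= (f x) A (trans (sym (lookup∘tabulate (λ x → lookup A (f x)) x)) ([]=⇒lookup m))

∈-preimage⁺ : ∀ {m n} (f : Fin m → Fin n) A x → f x ∈ A → x ∈ preimage f A
∈-preimage⁺ f A x m =
  lookup⇒[]= x (preimage f A) (trans (lookup∘tabulate (λ x → lookup A (f x)) x) ([]=⇒lookup m))

Star-collapse : ∀ {A B : Set} {R : A → A → Set} {S : B → B → Set} (f : A → B) →
  (∀ {x y} → R x y → S (f x) (f y) ⊎ f x ≡ f y) → ∀ {x y} → Star R x y → Star S (f x) (f y)
Star-collapse f move ε = ε
Star-collapse {S = S} f move {y = y} (r ◅ p) with move r
... | inj₁ s = s ◅ Star-collapse f move p
... | inj₂ e = subst (λ z → Star S z (f y)) (sym e) (Star-collapse f move p)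

Star-invariant : ∀ {A : Set} {R : A → A → Set} (P : A → Set) →
  (∀ {x y} → R x y → P x → P y) → ∀ {x y} → Star R x y → P x → P y
Star-invariant P preserve = fold (λ x y → P x → P y) (λ r k → k ∘ preserve r) id

Connected : ∀ {n} → Graph n → Set
Connected {n} G = ∀ (a b : Fin n) → Star (Adj G) a b

Removed : ∀ {n} → Fin n → Fin n → Fin n → Fin n → Set
Removed w u x y = (x ≡ w × y ≡ u) ⊎ (x ≡ u × y ≡ w)

Removed-cong : ∀ {n m} (f : Fin n → Fin m) {w u x y} → Removed w u x y → Removed (f w) (f u) (f x) (f y)
Removed-cong f (inj₁ (e₁ , e₂)) = inj₁ (cong f e₁ , cong f e₂)
Removed-cong f (inj₂ (e₁ , e₂)) = inj₂ (cong f e₁ , cong f e₂)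

Removed-reflect : ∀ {n m} {f : Fin n → Fin m} → (∀ {x y} → f x ≡ f y → x ≡ y) →
  ∀ {w u x y} → Removed (f w) (f u) (f x) (f y) → Removed w u x y
Removed-reflect inj (inj₁ (e₁ , e₂)) = inj₁ (inj e₁ , inj e₂)
Removed-reflect inj (inj₂ (e₁ , e₂)) = inj₂ (inj e₁ , inj e₂)

InBranch-map : ∀ {n m} {G : Graph n} {K : Graph m} (f : Fin n → Fin m) →
  (∀ {x y} → Adj G x y → Adj K (f x) (f y)) → (∀ {x y} → f x ≡ f y → x ≡ y) →
  ∀ {w u x} → InBranch G w u x → InBranch K (f w) (f u) (f x)
InBranch-map f adj inj = gmap f λ { (h , keep) → adj h , keep ∘ Removed-reflect inj }

branch-unique : ∀ {n} {G : Graph n} {w u A₁ A₂} → IsBranch G w u A₁ → IsBranch G w u A₂ → A₁ ⊆ A₂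
branch-unique (_ , mem₁) (_ , mem₂) {x} m = proj₂ (mem₂ x) (proj₁ (mem₁ x) m)

root∈branch : ∀ {n} {G : Graph n} {w u A} → IsBranch G w u A → u ∈ A
root∈branch {u = u} (_ , mem) = proj₂ (mem u) ε

Comparable : ∀ {n} → Fin n → Fin n → Subset n → Fin n → Fin n → Subset n → Set
Comparable w₁ u₁ A₁ w₂ u₂ A₂ = (w₁ ≡ w₂ × u₁ ≡ u₂) ⊎ (A₁ ⊂ A₂) ⊎ (A₂ ⊂ A₁)

comparable-sym : ∀ {n} {w₁ u₁ w₂ u₂ : Fin n} {A₁ A₂} → Comparable w₁ u₁ A₁ w₂ u₂ A₂ → Comparable w₂ u₂ A₂ w₁ u₁ A₁
comparable-sym (inj₁ (refl , refl)) = inj₁ (refl , refl)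
comparable-sym (inj₂ (inj₁ A₁⊂A₂)) = inj₂ (inj₂ A₁⊂A₂)
comparable-sym (inj₂ (inj₂ A₂⊂A₁)) = inj₂ (inj₁ A₂⊂A₁)

comparable-same-size : ∀ {n} {w₁ u₁ w₂ u₂ : Fin n} {A₁ A₂} →
  Comparable w₁ u₁ A₁ w₂ u₂ A₂ → ∣ A₁ ∣ ≡ ∣ A₂ ∣ → w₁ ≡ w₂ × u₁ ≡ u₂
comparable-same-size (inj₁ same-edge) _ = same-edge
comparable-same-size (inj₂ (inj₁ A₁⊂A₂)) sz = ⊥-elim (<-irrefl sz (p⊂q⇒∣p∣<∣q∣ A₁⊂A₂))
comparable-same-size (inj₂ (inj₂ A₂⊂A₁)) sz = ⊥-elim (<-irrefl (sym sz) (p⊂q⇒∣p∣<∣q∣ A₂⊂A₁))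

same-edge-carried : ∀ {n} {G : Graph n} {w₁ u₁ w₂ u₂ A₁ A₂} → w₁ ≡ w₂ × u₁ ≡ u₂ →
  IsBranch G w₁ u₁ A₁ → IsBranch G w₂ u₂ A₂ → AutCarrying G A₁ u₁ A₂ u₂
same-edge-carried (refl , refl) br₁ br₂ =
  Perm.id , (λ _ _ → refl) , (λ x → branch-unique br₁ br₂ , branch-unique br₂ br₁) , refl

aut⇒rootedIso : ∀ {n} {G : Graph n} {A₁ u₁ A₂ u₂} → AutCarrying G A₁ u₁ A₂ u₂ → RootedIso G A₁ u₁ A₂ u₂
aut⇒rootedIso (σ , adj , mem , root) =
    (σ ⟨$⟩ʳ_) , (λ x m → proj₁ (mem x) m)
  , (λ x y _ _ e → trans (sym (inverseˡ σ)) (trans (cong (σ ⟨$⟩ˡ_) e) (inverseˡ σ)))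
  , (λ y m → σ ⟨$⟩ˡ y , proj₂ (mem (σ ⟨$⟩ˡ y)) (subst (_∈ _) (sym (inverseʳ σ)) m) , inverseʳ σ)
  , (λ x y _ _ → adj x y) , root

Nesting : ∀ {n} → Graph n → Set
Nesting {n} G = ∀ {w₁ u₁ A₁ w₂ u₂ A₂} (r s : Fin n) → IsBranch G w₁ u₁ A₁ → IsBranch G w₂ u₂ A₂ →
  r ∈ A₁ → r ∈ A₂ → s ∉ A₁ → s ∉ A₂ → Comparable w₁ u₁ A₁ w₂ u₂ A₂

AvoidingIso : ∀ {n} → Graph n → Set
AvoidingIso {n} G = ∀ {w₁ u₁ A₁ w₂ u₂ A₂} (s : Fin n) → IsBranch G w₁ u₁ A₁ → IsBranch G w₂ u₂ A₂ →
  s ∉ A₁ → s ∉ A₂ → ∣ A₁ ∣ ≡ ∣ A₂ ∣ → RootedIso G A₁ u₁ A₂ u₂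

BranchSymmetry : ∀ {n} → Graph n → Set
BranchSymmetry {n} T = ∀ (w₁ u₁ w₂ u₂ : Fin n) (A₁ A₂ : Subset n) →
    IsBranch T w₁ u₁ A₁ → IsBranch T w₂ u₂ A₂ →
    (∣ A₁ ∣ ≡ ∣ A₂ ∣ → 2 * ∣ A₁ ∣ ≤ n → RootedIso T A₁ u₁ A₂ u₂)
    × (∣ A₁ ∣ ≡ ∣ A₂ ∣ → n < 4 * ∣ A₁ ∣ → 2 * ∣ A₁ ∣ ≤ n → AutCarrying T A₁ u₁ A₂ u₂)

module Transport {n} (G T : Graph n) (σ : Permutation′ n)
                 (σ-adj : ∀ x y → T (σ ⟨$⟩ʳ x) (σ ⟨$⟩ʳ y) ≡ G x y) where

  to from : Fin n → Fin n
  to x = σ ⟨$⟩ʳ x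
  from x = σ ⟨$⟩ˡ x

  to-from : ∀ x → to (from x) ≡ x
  to-from x = inverseʳ σ

  from-to : ∀ x → from (to x) ≡ x
  from-to x = inverseˡ σ

  to-injective : ∀ {x y} → to x ≡ to y → x ≡ y
  to-injective {x} {y} e = trans (sym (from-to x)) (trans (cong from e) (from-to y))

  from-injective : ∀ {x y} → from x ≡ from y → x ≡ y
  from-injective {x} {y} e = trans (sym (to-from x)) (trans (cong to e) (to-from y))

  adj-from : ∀ x y → G (from x) (from y) ≡ T x y
  adj-from x y = trans (sym (σ-adj (from x) (from y))) (cong₂ T (to-from x) (to-from y))

  pull : Subset n → Subset n
  pull = preimage to

  pull-in : ∀ A x → x ∈ A → from x ∈ pull A
  pull-in A x m = ∈-preimage⁺ to A (from x) (subst (_∈ A) (sym (to-from x)) m)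

  pull-size : ∀ A → ∣ pull A ∣ ≡ ∣ A ∣
  pull-size A = ≤-antisym
    (card-≤ (pull A) A to (∈-preimage⁻ to A) (λ _ _ _ _ → to-injective))
    (card-≤ A (pull A) from (pull-in A) (λ _ _ _ _ → from-injective))

  pull-branch : ∀ {w u A} → IsBranch T w u A → IsBranch G (from w) (from u) (pull A)
  pull-branch {w} {u} {A} (adj , mem) =
    trans (adj-from w u) adj ,
    λ x → (λ m → back (proj₁ (mem (to x)) (∈-preimage⁻ to A x m)))
        , (λ p → ∈-preimage⁺ to A x (proj₂ (mem (to x)) (forth p)))
    where
    forth : ∀ {x} → InBranch G (from w) (from u) x → InBranch T w u (to x)
    forth {x} p = subst₂ (λ w′ u′ → InBranch T w′ u′ (to x)) (to-from w) (to-from u)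
      (InBranch-map to (λ {x} {y} h → trans (σ-adj x y) h) to-injective p)
    back : ∀ {x} → InBranch T w u (to x) → InBranch G (from w) (from u) x
    back {x} p = subst (InBranch G (from w) (from u)) (from-to x)
      (InBranch-map from (λ {x} {y} h → trans (adj-from x y) h) from-injective p)

  push-iso : ∀ {A₁ u₁ A₂ u₂} → RootedIso G (pull A₁) (from u₁) (pull A₂) (from u₂) → RootedIso T A₁ u₁ A₂ u₂
  push-iso {A₁} {u₁} {A₂} {u₂} (f , maps , inj , onto , adj , root) =
    F , (λ x m → ∈-preimage⁻ to A₂ _ (maps _ (pull-in A₁ x m)))
      , (λ x y mx my e → from-injective (inj _ _ (pull-in A₁ x mx) (pull-in A₁ y my) (to-injective e)))
      , F-onto
      , (λ x y mx my → trans (σ-adj _ _) (trans (adj _ _ (pull-in A₁ x mx) (pull-in A₁ y my)) (adj-from x y)))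
      , trans (cong to root) (to-from u₂)
    where
    F : Fin n → Fin n
    F x = to (f (from x))
    F-onto : ∀ y → y ∈ A₂ → Σ (Fin n) λ x → x ∈ A₁ × F x ≡ y
    F-onto y m with onto (from y) (pull-in A₂ y m)
    ... | x , mx , e = to x , ∈-preimage⁻ to A₁ x mx , trans (cong (to ∘ f) (from-to x)) (trans (cong to e) (to-from y))

  push-aut : ∀ {A₁ u₁ A₂ u₂} → AutCarrying G (pull A₁) (from u₁) (pull A₂) (from u₂) → AutCarrying T A₁ u₁ A₂ u₂
  push-aut {A₁} {u₁} {A₂} {u₂} (π , adj , mem , root) =
    Perm.flip σ ∘ₚ (π ∘ₚ σ) , (λ x y → trans (σ-adj _ _) (trans (adj _ _) (adj-from x y))) , moves , trans (cong to root) (to-from u₂)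
    where
    moves : ∀ x → (x ∈ A₁ → to (π ⟨$⟩ʳ from x) ∈ A₂) × (to (π ⟨$⟩ʳ from x) ∈ A₂ → x ∈ A₁)
    moves x = (λ m → ∈-preimage⁻ to A₂ _ (proj₁ (mem (from x)) (pull-in A₁ x m)))
            , (λ m → subst (_∈ A₁) (to-from x) (∈-preimage⁻ to A₁ _ (proj₂ (mem (from x)) (∈-preimage⁺ to A₂ _ m))))

  transport-symmetry : BranchSymmetry G → BranchSymmetry T
  transport-symmetry symG w₁ u₁ w₂ u₂ A₁ A₂ br₁ br₂ =
      (λ sz small → push-iso (proj₁ pulled (pulled-size sz) (resize (λ k → 2 * k ≤ n) small)))
    , (λ sz large small → push-aut (proj₂ pulled (pulled-size sz)
                                     (resize (λ k → n < 4 * k) large) (resize (λ k → 2 * k ≤ n) small)))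
    where
    pulled : (∣ pull A₁ ∣ ≡ ∣ pull A₂ ∣ → 2 * ∣ pull A₁ ∣ ≤ n →
                RootedIso G (pull A₁) (from u₁) (pull A₂) (from u₂))
           × (∣ pull A₁ ∣ ≡ ∣ pull A₂ ∣ → n < 4 * ∣ pull A₁ ∣ → 2 * ∣ pull A₁ ∣ ≤ n →
                AutCarrying G (pull A₁) (from u₁) (pull A₂) (from u₂))
    pulled = symG _ _ _ _ (pull A₁) (pull A₂) (pull-branch br₁) (pull-branch br₂)
    resize : (P : ℕ → Set) → P ∣ A₁ ∣ → P ∣ pull A₁ ∣
    resize P = subst P (sym (pull-size A₁))
    pulled-size : ∣ A₁ ∣ ≡ ∣ A₂ ∣ → ∣ pull A₁ ∣ ≡ ∣ pull A₂ ∣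
    pulled-size sz = trans (pull-size A₁) (trans sz (sym (pull-size A₂)))

data Relative (c : Bool) : Bool → Set where
  same  : Relative c c
  other : Relative c (not c)

relative : ∀ c d → Relative c d
relative false false = same
relative false true  = other
relative true  false = other
relative true  true  = same

c≢not-c : ∀ {c} → c ≢ not c
c≢not-c = not-¬ refl

-- The vertex set Fin (N + N) as two copies, indexed by Bool, of Fin N.
module Copies (N : ℕ) where

  emb : Bool → Fin N → Fin (N + N)
  emb false v = v ↑ˡ N
  emb true  v = N ↑ʳ v

  split : Fin (N + N) → Bool × Fin N
  split x with splitAt N x
  ... | inj₁ v = false , v
  ... | inj₂ v = true , v

  split-emb : ∀ c v → split (emb c v) ≡ (c , v)
  split-emb false v rewrite splitAt-↑ˡ N v N = refl
  split-emb true  v rewrite splitAt-↑ʳ N N v = refl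

  emb-split : ∀ x → emb (proj₁ (split x)) (proj₂ (split x)) ≡ x
  emb-split x with splitAt N x in eq
  ... | inj₁ v = trans (cong (join N N) (sym eq)) (join-splitAt N N x)
  ... | inj₂ v = trans (cong (join N N) (sym eq)) (join-splitAt N N x)

  emb-injective : ∀ {c d v w} → emb c v ≡ emb d w → c ≡ d × v ≡ w
  emb-injective {c} {d} {v} {w} e with trans (sym (split-emb c v)) (trans (cong split e) (split-emb d w))
  ... | refl = refl , refl

  emb-cancel : ∀ {c v w} → emb c v ≡ emb c w → v ≡ w
  emb-cancel {c} e = proj₂ (emb-injective {c} {c} e)

  copies-differ : ∀ c {v w} → emb c v ≢ emb (not c) w
  copies-differ c e = c≢not-c (proj₁ (emb-injective {c} {not c} e))

  side : Fin (N + N) → Bool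
  side x = proj₁ (split x)

  side-emb : ∀ c v → side (emb c v) ≡ c
  side-emb c v = cong proj₁ (split-emb c v)

  data CopyView : Fin (N + N) → Set where
    copy : ∀ c v → CopyView (emb c v)

  view : ∀ x → CopyView x
  view x = subst CopyView (emb-split x) (copy (proj₁ (split x)) (proj₂ (split x)))

data Size : Set where
  below half above : Size

module Mirror {N : ℕ} (H : Graph N) (q : Fin N) where
  open Copies N

  T : Graph (N + N)
  T = mirror H q

  mirror-within : ∀ c a b → mirror H q (emb c a) (emb c b) ≡ H a b
  mirror-within false a b rewrite splitAt-↑ˡ N a N | splitAt-↑ˡ N b N = refl
  mirror-within true  a b rewrite splitAt-↑ʳ N N a | splitAt-↑ʳ N N b = refl

  mirror-across : ∀ c a b → mirror H q (emb c a) (emb (not c) b) ≡ does (a ≟ q) ∧ does (b ≟ q)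
  mirror-across false a b rewrite splitAt-↑ˡ N a N | splitAt-↑ʳ N N b = refl
  mirror-across true  a b rewrite splitAt-↑ʳ N N a | splitAt-↑ˡ N b N = refl

  copy-adj : ∀ c {a b} → Adj H a b → Adj T (emb c a) (emb c b)
  copy-adj c {a} {b} = trans (mirror-within c a b)

  bridge-adj : ∀ c → Adj T (emb c q) (emb (not c) q)
  bridge-adj c = trans (mirror-across c q q) (cong₂ _∧_ (dec-true (q ≟ q) refl) (dec-true (q ≟ q) refl))

  cross-adj : ∀ c a b → Adj T (emb c a) (emb (not c) b) → a ≡ q × b ≡ q
  cross-adj c a b adj = both-q (trans (sym (mirror-across c a b)) adj)
    where
    both-q : does (a ≟ q) ∧ does (b ≟ q) ≡ true → a ≡ q × b ≡ q
    both-q h with a ≟ q | b ≟ q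
    ... | yes a≡q | yes b≡q = a≡q , b≡q
    both-q () | yes _ | no _
    both-q () | no _  | _

  cross-adj′ : ∀ c a b → Adj T (emb (not c) a) (emb c b) → a ≡ q × b ≡ q
  cross-adj′ false = cross-adj true
  cross-adj′ true  = cross-adj false

  mirror-connected : Connected H → Connected T
  mirror-connected conH x y with view x | view y
  ... | copy c a | copy d b with relative c d
  ... | same  = gmap (emb c) (copy-adj c) (conH a b)
  ... | other = gmap (emb c) (copy-adj c) (conH a q)
                  ◅◅ bridge-adj c ◅ gmap (emb (not c)) (copy-adj (not c)) (conH q b)

  swap : Fin (N + N) → Fin (N + N)
  swap x = emb (not (proj₁ (split x))) (proj₂ (split x))

  swap-emb : ∀ c v → swap (emb c v) ≡ emb (not c) v
  swap-emb c v rewrite split-emb c v = refl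

  swap-involutive : ∀ x → swap (swap x) ≡ x
  swap-involutive x with view x
  ... | copy c v = begin
    swap (swap (emb c v))  ≡⟨ cong swap (swap-emb c v) ⟩
    swap (emb (not c) v)   ≡⟨ swap-emb (not c) v ⟩
    emb (not (not c)) v    ≡⟨ cong (λ d → emb d v) (not-involutive c) ⟩
    emb c v                ∎
    where open ≡-Reasoning

  swap-adj : ∀ x y → T (swap x) (swap y) ≡ T x y
  swap-adj x y with view x | view y
  ... | copy c v | copy d w rewrite swap-emb c v | swap-emb d w with relative c d
  ... | same  = trans (mirror-within (not c) v w) (sym (mirror-within c v w))
  ... | other = trans (mirror-across (not c) v w) (sym (mirror-across c v w))

  swap-perm : Permutation′ (N + N)
  swap-perm = permutation swap swap swap-involutive swap-involutive

  keep-if : Bool → Bool → Fin N → Fin N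
  keep-if false false v = v
  keep-if false true  v = q
  keep-if true  false v = q
  keep-if true  true  v = v

  -- The retraction of T onto copy c, collapsing the other copy onto q.
  retract : Bool → Fin (N + N) → Fin N
  retract c x = keep-if c (proj₁ (split x)) (proj₂ (split x))

  retract-own : ∀ c v → retract c (emb c v) ≡ v
  retract-own false v rewrite split-emb false v = refl
  retract-own true  v rewrite split-emb true v = refl

  retract-other : ∀ c v → retract c (emb (not c) v) ≡ q
  retract-other false v rewrite split-emb true v = refl
  retract-other true  v rewrite split-emb false v = refl

  retract-step : ∀ c {a b x y} → AdjMinus T (emb c a) (emb c b) x y →
    AdjMinus H a b (retract c x) (retract c y) ⊎ retract c x ≡ retract c y
  retract-step c {x = x} {y} (adj , keep) with view x | view y
  ... | copy d v | copy d′ v′ with relative c d | relative c d′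
  ... | same | same rewrite retract-own c v | retract-own c v′ =
    inj₁ (trans (sym (mirror-within c v v′)) adj , keep ∘ Removed-cong (emb c))
  ... | same | other = inj₂ (begin
    retract c (emb c v)        ≡⟨ cong (retract c ∘ emb c) (proj₁ (cross-adj c v v′ adj)) ⟩
    retract c (emb c q)        ≡⟨ retract-own c q ⟩
    q                          ≡⟨ sym (retract-other c v′) ⟩
    retract c (emb (not c) v′) ∎)
    where open ≡-Reasoning
  ... | other | same = inj₂ (begin
    retract c (emb (not c) v)  ≡⟨ retract-other c v ⟩
    q                          ≡⟨ sym (retract-own c q) ⟩
    retract c (emb c q)        ≡⟨ cong (retract c ∘ emb c) (sym (proj₂ (cross-adj′ c v v′ adj))) ⟩
    retract c (emb c v′)       ∎)
    where open ≡-Reasoning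
  ... | other | other = inj₂ (trans (retract-other c v) (sym (retract-other c v′)))

  project-branch : ∀ c {a b x} → InBranch T (emb c a) (emb c b) x → InBranch H a b (retract c x)
  project-branch c {a} {b} {x} p = subst (λ z → Star (AdjMinus H a b) z (retract c x)) (retract-own c b)
    (Star-collapse (retract c) (retract-step c) p)

  lift-branch : ∀ c {a b y} → InBranch H a b y → InBranch T (emb c a) (emb c b) (emb c y)
  lift-branch c = InBranch-map (emb c) (copy-adj c) (emb-cancel {c})

  lift-avoiding : ∀ c {w u} → (∀ x y → ¬ Removed w u (emb c x) (emb c y)) →
    ∀ {a b} → Star (Adj H) a b → Star (AdjMinus T w u) (emb c a) (emb c b)
  lift-avoiding c keep = gmap (emb c) (λ h → copy-adj c h , keep _ _)

  InCopy : Bool → Subset (N + N) → Set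
  InCopy c A = ∀ d v → emb d v ∈ A → d ≡ c

  Covers : Bool → Subset (N + N) → Set
  Covers c A = ∀ v → emb c v ∈ A

  record Trace (c : Bool) (B : Subset N) (A : Subset (N + N)) : Set where
    field
      trace⁺ : ∀ v → v ∈ B → emb c v ∈ A
      trace⁻ : ∀ v → emb c v ∈ A → v ∈ B
  open Trace

  covered-trace : ∀ {c A} → Covers c A → Trace c ⊤ A
  covered-trace cov = record { trace⁺ = λ v _ → cov v ; trace⁻ = λ _ _ → ∈⊤ }

  copy-⊆ : ∀ {c A A′} → InCopy c A → Covers c A′ → A ⊆ A′
  copy-⊆ ic cov {x} m with view x
  ... | copy d v with ic d v m
  ... | refl = cov v

  uncovered : ∀ c d {A v} → Covers c A → emb d v ∉ A → c ≡ not d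
  uncovered c d cov v∉A with relative d c
  ... | same  = ⊥-elim (v∉A (cov _))
  ... | other = refl

  outside-copy : ∀ {c A A′} → InCopy c A → ∀ v → emb (not c) v ∈ A → emb (not c) v ∈ A′
  outside-copy ic v m = ⊥-elim (c≢not-c (sym (ic _ v m)))

  retract-injective : ∀ {c A} → InCopy c A → ∀ x y → x ∈ A → y ∈ A → retract c x ≡ retract c y → x ≡ y
  retract-injective {c} ic x y mx my e with view x | view y
  ... | copy d v | copy d′ v′ with ic d v mx | ic d′ v′ my
  ... | refl | refl = cong (emb c) (trans (sym (retract-own c v)) (trans e (retract-own c v′)))

  retract-maps : ∀ {c B A} → InCopy c A → Trace c B A → ∀ x → x ∈ A → retract c x ∈ B
  retract-maps {c} {B} ic tr x m with view x
  ... | copy d v with ic d v m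
  ... | refl = subst (_∈ B) (sym (retract-own c v)) (trace⁻ tr v m)

  size-trace : ∀ {c B A} → InCopy c A → Trace c B A → ∣ A ∣ ≡ ∣ B ∣
  size-trace {c} {B} {A} ic tr = ≤-antisym
    (card-≤ A B (retract c) (retract-maps ic tr) (retract-injective ic))
    (card-≤ B A (emb c) (trace⁺ tr) (λ _ _ _ _ → emb-cancel {c}))

  size-beyond : ∀ {c A b} → Covers (not c) A → emb c b ∈ A → N < ∣ A ∣
  size-beyond {c} {A} {b} cov m = subst (_< ∣ A ∣) (∣⊤∣≡n N)
    (card-< ⊤ A (emb (not c)) (λ v _ → cov v) (λ _ _ _ _ → emb-cancel {not c}) (emb c b) m
      (λ v _ e → copies-differ c (sym e)))

  lift-⊂ : ∀ {c B₁ B₂ A₁ A₂} → Trace c B₁ A₁ → Trace c B₂ A₂ →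
    (∀ v → emb (not c) v ∈ A₁ → emb (not c) v ∈ A₂) → B₁ ⊂ B₂ → A₁ ⊂ A₂
  lift-⊂ {c} {A₁ = A₁} {A₂} tr₁ tr₂ elsewhere (B₁⊆B₂ , v , v∈B₂ , v∉B₁) =
    A₁⊆A₂ , emb c v , trace⁺ tr₂ v v∈B₂ , v∉B₁ ∘ trace⁻ tr₁ v
    where
    A₁⊆A₂ : A₁ ⊆ A₂
    A₁⊆A₂ {x} m with view x
    ... | copy d w with relative c d
    ... | same  = trace⁺ tr₂ w (B₁⊆B₂ (trace⁻ tr₁ w m))
    ... | other = elsewhere w m

  lift-comparable : ∀ {c a₁ b₁ a₂ b₂ B₁ B₂ A₁ A₂} → Trace c B₁ A₁ → Trace c B₂ A₂ →
    (∀ v → emb (not c) v ∈ A₁ → emb (not c) v ∈ A₂) → (∀ v → emb (not c) v ∈ A₂ → emb (not c) v ∈ A₁) →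
    Comparable a₁ b₁ B₁ a₂ b₂ B₂ → Comparable (emb c a₁) (emb c b₁) A₁ (emb c a₂) (emb c b₂) A₂
  lift-comparable tr₁ tr₂ _ _ (inj₁ (refl , refl)) = inj₁ (refl , refl)
  lift-comparable tr₁ tr₂ sub _ (inj₂ (inj₁ B₁⊂B₂)) = inj₂ (inj₁ (lift-⊂ tr₁ tr₂ sub B₁⊂B₂))
  lift-comparable tr₁ tr₂ _ sup (inj₂ (inj₂ B₂⊂B₁)) = inj₂ (inj₂ (lift-⊂ tr₂ tr₁ sup B₂⊂B₁))

  lift-rooted-iso : ∀ {c₁ c₂ B₁ B₂ A₁ A₂ b₁ b₂} → InCopy c₁ A₁ → Trace c₁ B₁ A₁ → InCopy c₂ A₂ → Trace c₂ B₂ A₂ →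
    RootedIso H B₁ b₁ B₂ b₂ → RootedIso T A₁ (emb c₁ b₁) A₂ (emb c₂ b₂)
  lift-rooted-iso {c₁} {c₂} {B₁} {B₂} {A₁} {A₂} {b₁} {b₂} in₁ tr₁ in₂ tr₂ (f , maps , inj , onto , adj , root) =
    F , (λ x m → trace⁺ tr₂ _ (maps _ (retract-maps in₁ tr₁ x m)))
      , (λ x y mx my e → retract-injective in₁ x y mx my
                           (inj _ _ (retract-maps in₁ tr₁ x mx) (retract-maps in₁ tr₁ y my) (emb-cancel {c₂} e)))
      , F-onto , F-adj , cong (emb c₂) (trans (cong f (retract-own c₁ b₁)) root)
    where
    F : Fin (N + N) → Fin (N + N)
    F x = emb c₂ (f (retract c₁ x))
    F-onto : ∀ y → y ∈ A₂ → Σ (Fin (N + N)) λ x → x ∈ A₁ × F x ≡ y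
    F-onto y m with view y
    ... | copy d v with in₂ d v m
    ... | refl with onto v (trace⁻ tr₂ v m)
    ... | x , mx , e = emb c₁ x , trace⁺ tr₁ x mx , cong (emb d) (trans (cong f (retract-own c₁ x)) e)
    F-adj : ∀ x y → x ∈ A₁ → y ∈ A₁ → T (F x) (F y) ≡ T x y
    F-adj x y mx my with view x | view y
    ... | copy d v | copy d′ v′ with in₁ d v mx | in₁ d′ v′ my
    ... | refl | refl rewrite retract-own d v | retract-own d v′ =
      trans (mirror-within c₂ (f v) (f v′)) (trans (adj v v′ (trace⁻ tr₁ v mx) (trace⁻ tr₁ v′ my)) (sym (mirror-within d v v′)))

  swap-into : ∀ {c d B A A′} → c ≢ d → InCopy c A → Trace c B A → Trace d B A′ → ∀ x → x ∈ A → swap x ∈ A′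
  swap-into {c} {d} {A′ = A′} c≢d ic tr tr′ x m with view x
  ... | copy e v with ic e v m
  ... | refl rewrite swap-emb e v =
    subst (λ e′ → emb e′ v ∈ A′) (¬-not (c≢d ∘ sym)) (trace⁺ tr′ v (trace⁻ tr v m))

  copies-carry : ∀ {c₁ c₂ B A₁ A₂ b} → InCopy c₁ A₁ → Trace c₁ B A₁ → InCopy c₂ A₂ → Trace c₂ B A₂ →
    AutCarrying T A₁ (emb c₁ b) A₂ (emb c₂ b)
  copies-carry {c₁} {c₂} {b = b} in₁ tr₁ in₂ tr₂ with relative c₁ c₂
  ... | same = Perm.id , (λ _ _ → refl) , (λ x → same-copy in₁ tr₁ tr₂ , same-copy in₂ tr₂ tr₁) , refl
    where
    same-copy : ∀ {B A A′} → InCopy c₁ A → Trace c₁ B A → Trace c₁ B A′ → A ⊆ A′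
    same-copy ic tr tr′ {x} m with view x
    ... | copy d v with ic d v m
    ... | refl = trace⁺ tr′ v (trace⁻ tr v m)
  ... | other =
    swap-perm , swap-adj ,
    (λ x → swap-into c≢not-c in₁ tr₁ tr₂ x ,
           λ m → subst (_∈ _) (swap-involutive x) (swap-into (c≢not-c ∘ sym) in₂ tr₂ tr₁ (swap x) m)) ,
    swap-emb c₁ b

  Sized : Size → ℕ → Set
  Sized below m = m < N
  Sized half  m = m ≡ N
  Sized above m = N < m

  sized-unique : ∀ {k k′ m} → Sized k m → Sized k′ m → k ≡ k′
  sized-unique {below} {below} _    _    = refl
  sized-unique {below} {half}  m<N  refl = ⊥-elim (<-irrefl refl m<N)
  sized-unique {below} {above} m<N  N<m  = ⊥-elim (<-asym m<N N<m)
  sized-unique {half}  {below} refl m<N  = ⊥-elim (<-irrefl refl m<N)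
  sized-unique {half}  {half}  _    _    = refl
  sized-unique {half}  {above} refl N<m  = ⊥-elim (<-irrefl refl N<m)
  sized-unique {above} {below} N<m  m<N  = ⊥-elim (<-asym m<N N<m)
  sized-unique {above} {half}  N<m  refl = ⊥-elim (<-irrefl refl N<m)
  sized-unique {above} {above} _    _    = refl

  data Shape : Size → Fin (N + N) → Fin (N + N) → Subset (N + N) → Set where
    bridge : ∀ c {A} → InCopy c A → Covers c A → Shape half (emb (not c) q) (emb c q) A
    within : ∀ c {a b B A} → IsBranch H a b B → Trace c B A → q ∉ B → InCopy c A →
             Shape below (emb c a) (emb c b) A
    beyond : ∀ c {a b B A} → IsBranch H a b B → Trace c B A → q ∈ B → Covers (not c) A →
             Shape above (emb c a) (emb c b) A

  shape-size : ∀ {k w u A} → Shape k w u A → Sized k ∣ A ∣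
  shape-size (bridge c ic cov) = trans (size-trace ic (covered-trace cov)) (∣⊤∣≡n N)
  shape-size (within c br tr q∉B ic) = subst (_< N) (sym (size-trace ic tr)) (missing⇒card< q∉B)
  shape-size (beyond c br tr q∈B cov) = size-beyond {c} cov (trace⁺ tr _ (root∈branch br))

  same-class : ∀ {k₁ k₂ w₁ u₁ A₁ w₂ u₂ A₂} → Shape k₁ w₁ u₁ A₁ → Shape k₂ w₂ u₂ A₂ → ∣ A₁ ∣ ≡ ∣ A₂ ∣ → k₁ ≡ k₂
  same-class σ₁ σ₂ sz = sized-unique (shape-size σ₁) (subst (Sized _) (sym sz) (shape-size σ₂))

  bridges-aut : ∀ {w₁ u₁ A₁ w₂ u₂ A₂} → Shape half w₁ u₁ A₁ → Shape half w₂ u₂ A₂ → AutCarrying T A₁ u₁ A₂ u₂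
  bridges-aut (bridge c₁ in₁ cov₁) (bridge c₂ in₂ cov₂) = copies-carry in₁ (covered-trace cov₁) in₂ (covered-trace cov₂)

  traces-equal-size : ∀ {c₁ c₂ B₁ B₂ A₁ A₂} → InCopy c₁ A₁ → Trace c₁ B₁ A₁ → InCopy c₂ A₂ → Trace c₂ B₂ A₂ →
    ∣ A₁ ∣ ≡ ∣ A₂ ∣ → ∣ B₁ ∣ ≡ ∣ B₂ ∣
  traces-equal-size in₁ tr₁ in₂ tr₂ sz = trans (sym (size-trace in₁ tr₁)) (trans sz (size-trace in₂ tr₂))

  module Classification (conH : Connected H) where

    bridge-side : ∀ c {x} → InBranch T (emb (not c) q) (emb c q) x → side x ≡ c
    bridge-side c p = Star-invariant (λ x → side x ≡ c) stays p (side-emb c q)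
      where
      stays : ∀ {x y} → AdjMinus T (emb (not c) q) (emb c q) x y → side x ≡ c → side y ≡ c
      stays {x} {y} (adj , keep) x-in-c with view x | view y
      ... | copy d v | copy d′ v′ with trans (sym (side-emb d v)) x-in-c | relative c d′
      ... | refl | same = side-emb c v′
      ... | refl | other with cross-adj c v v′ adj
      ... | refl , refl = ⊥-elim (keep (inj₂ (refl , refl)))

    classify-bridge : ∀ c {A} → IsBranch T (emb (not c) q) (emb c q) A → Shape half (emb (not c) q) (emb c q) A
    classify-bridge c (_ , mem) =
      bridge c (λ d v m → trans (sym (side-emb d v)) (bridge-side c (proj₁ (mem _) m)))
               (λ v → proj₂ (mem _) (lift-avoiding c off-bridge (conH q v)))
      where
      off-bridge : ∀ x y → ¬ Removed (emb (not c) q) (emb c q) (emb c x) (emb c y)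
      off-bridge x y (inj₁ (e , _)) = copies-differ c e
      off-bridge x y (inj₂ (_ , e)) = copies-differ c e

    cross-branch : ∀ c {a b} v → InBranch H a b q → InBranch T (emb c a) (emb c b) (emb (not c) v)
    cross-branch c {a} {b} v p = lift-branch c p ◅◅ (bridge-adj c , bridge-kept) ◅ lift-avoiding (not c) kept (conH q v)
      where
      bridge-kept : ¬ Removed (emb c a) (emb c b) (emb c q) (emb (not c) q)
      bridge-kept (inj₁ (_ , e)) = copies-differ c (sym e)
      bridge-kept (inj₂ (_ , e)) = copies-differ c (sym e)
      kept : ∀ x y → ¬ Removed (emb c a) (emb c b) (emb (not c) x) (emb (not c) y)
      kept x y (inj₁ (e , _)) = copies-differ c (sym e)
      kept x y (inj₂ (e , _)) = copies-differ c (sym e)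

    classify-inner : ∀ c {a b A} → IsBranch T (emb c a) (emb c b) A → Σ Size λ k → Shape k (emb c a) (emb c b) A
    classify-inner c {a} {b} {A} (adj , mem) = decide (q ∈? B)
      where
      B : Subset N
      B = preimage (emb c) A
      tr : Trace c B A
      tr = record { trace⁺ = ∈-preimage⁻ (emb c) A ; trace⁻ = ∈-preimage⁺ (emb c) A }
      branchH : IsBranch H a b B
      branchH = trans (sym (mirror-within c a b)) adj ,
        λ y → (λ y∈B → subst (InBranch H a b) (retract-own c y) (project-branch c (proj₁ (mem _) (trace⁺ tr y y∈B))))
            , (λ p → trace⁻ tr y (proj₂ (mem _) (lift-branch c p)))
      confined : q ∉ B → InCopy c A
      confined q∉B d v m with relative c d
      ... | same  = refl
      ... | other = ⊥-elim (q∉B (proj₂ (proj₂ branchH q)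
                      (subst (InBranch H a b) (retract-other c v) (project-branch c (proj₁ (mem _) m)))))
      decide : Dec (q ∈ B) → Σ Size λ k → Shape k (emb c a) (emb c b) A
      decide (yes q∈B) = above , beyond c branchH tr q∈B
        (λ v → proj₂ (mem _) (cross-branch c v (proj₁ (proj₂ branchH q) q∈B)))
      decide (no q∉B) = below , within c branchH tr q∉B (confined q∉B)

    classify : ∀ {w u A} → IsBranch T w u A → Σ Size λ k → Shape k w u A
    classify {w} {u} br with view w | view u
    ... | copy c a | copy d b with relative c d
    ... | same = classify-inner c br
    ... | other with cross-adj c a b (proj₁ br)
    ... | refl , refl = half , bridge-edge c br
      where
      bridge-edge : ∀ c {A} → IsBranch T (emb c q) (emb (not c) q) A → Shape half (emb c q) (emb (not c) q) A
      bridge-edge false = classify-bridge true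
      bridge-edge true  = classify-bridge false

    classify-equal : ∀ {w₁ u₁ A₁ w₂ u₂ A₂} → IsBranch T w₁ u₁ A₁ → IsBranch T w₂ u₂ A₂ → ∣ A₁ ∣ ≡ ∣ A₂ ∣ →
      Σ Size λ k → Shape k w₁ u₁ A₁ × Shape k w₂ u₂ A₂
    classify-equal br₁ br₂ sz with classify br₁ | classify br₂
    ... | k₁ , σ₁ | k₂ , σ₂ with same-class σ₁ σ₂ sz
    ... | refl = k₁ , σ₁ , σ₂

    module _ (nestH : Nesting H) where

      nest-bridges : ∀ {w₁ u₁ A₁ w₂ u₂ A₂} r → Shape half w₁ u₁ A₁ → Shape half w₂ u₂ A₂ →
        r ∈ A₁ → r ∈ A₂ → Comparable w₁ u₁ A₁ w₂ u₂ A₂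
      nest-bridges r (bridge c₁ in₁ _) (bridge c₂ in₂ _) r₁ r₂ with view r
      ... | copy d v with in₁ d v r₁ | in₂ d v r₂
      ... | refl | refl = inj₁ (refl , refl)

      nest-bridge-within : ∀ {w₁ u₁ A₁ w₂ u₂ A₂} r → Shape half w₁ u₁ A₁ → Shape below w₂ u₂ A₂ →
        r ∈ A₁ → r ∈ A₂ → A₂ ⊂ A₁
      nest-bridge-within r (bridge c₁ in₁ cov₁) (within c₂ _ tr₂ q∉B₂ in₂) r₁ r₂ with view r
      ... | copy d v with in₁ d v r₁ | in₂ d v r₂
      ... | refl | refl = copy-⊆ in₂ cov₁ , emb d q , cov₁ q , q∉B₂ ∘ trace⁻ tr₂ q

      -- A whole copy and a beyond-branch missing a common vertex: the copy is the other
      -- copy of the beyond-branch, hence lies inside it.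
      nest-bridge-beyond : ∀ {w₁ u₁ A₁ w₂ u₂ A₂} s → Shape half w₁ u₁ A₁ → Shape above w₂ u₂ A₂ →
        s ∉ A₁ → s ∉ A₂ → A₁ ⊂ A₂
      nest-bridge-beyond s (bridge c₁ in₁ cov₁) (beyond c₂ {b = b₂} br₂ tr₂ _ cov₂) s₁ s₂ with view s
      ... | copy d v with uncovered c₁ d cov₁ s₁ | not-injective (uncovered (not c₂) d cov₂ s₂)
      ... | refl | refl = copy-⊆ in₁ cov₂ , emb d b₂ , trace⁺ tr₂ b₂ (root∈branch br₂) , c≢not-c ∘ in₁ d b₂

      -- Two within-branches sharing a vertex lie in the same copy; use Nesting for H with q.
      nest-withins : ∀ {w₁ u₁ A₁ w₂ u₂ A₂} r → Shape below w₁ u₁ A₁ → Shape below w₂ u₂ A₂ →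
        r ∈ A₁ → r ∈ A₂ → Comparable w₁ u₁ A₁ w₂ u₂ A₂
      nest-withins r (within c₁ br₁ tr₁ q∉B₁ in₁) (within c₂ br₂ tr₂ q∉B₂ in₂) r₁ r₂ with view r
      ... | copy d v with in₁ d v r₁ | in₂ d v r₂
      ... | refl | refl = lift-comparable tr₁ tr₂ (outside-copy in₁) (outside-copy in₂)
                            (nestH v q br₁ br₂ (trace⁻ tr₁ v r₁) (trace⁻ tr₂ v r₂) q∉B₁ q∉B₂)

      -- A within-branch and a beyond-branch sharing a vertex and missing a vertex: the first
      -- lies in the other copy of the second, or both are in one copy and q forces B₁ ⊂ B₂.
      nest-within-beyond : ∀ {w₁ u₁ A₁ w₂ u₂ A₂} r s → Shape below w₁ u₁ A₁ → Shape above w₂ u₂ A₂ →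
        r ∈ A₁ → r ∈ A₂ → s ∉ A₁ → s ∉ A₂ → A₁ ⊂ A₂
      nest-within-beyond r s (within c₁ br₁ tr₁ q∉B₁ in₁) (beyond c₂ {b = b₂} br₂ tr₂ q∈B₂ cov₂) r₁ r₂ s₁ s₂
        with view r | view s
      ... | copy d v | copy d′ v′ with in₁ d v r₁ | not-injective (uncovered (not c₂) d′ cov₂ s₂)
      ... | refl | refl with relative c₂ c₁
      ... | other = copy-⊆ in₁ cov₂ , emb c₂ b₂ , trace⁺ tr₂ b₂ (root∈branch br₂) , c≢not-c ∘ in₁ c₂ b₂
      ... | same with nestH v v′ br₁ br₂ (trace⁻ tr₁ v r₁) (trace⁻ tr₂ v r₂) (s₁ ∘ trace⁺ tr₁ v′) (s₂ ∘ trace⁺ tr₂ v′)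
      ... | inj₁ (refl , refl) = ⊥-elim (q∉B₁ (branch-unique br₂ br₁ q∈B₂))
      ... | inj₂ (inj₁ B₁⊂B₂) = lift-⊂ tr₁ tr₂ (outside-copy in₁) B₁⊂B₂
      ... | inj₂ (inj₂ (B₂⊆B₁ , _)) = ⊥-elim (q∉B₁ (B₂⊆B₁ q∈B₂))

      -- Two beyond-branches missing a vertex lie in the same copy; use Nesting for H with q.
      nest-beyonds : ∀ {w₁ u₁ A₁ w₂ u₂ A₂} s → Shape above w₁ u₁ A₁ → Shape above w₂ u₂ A₂ →
        s ∉ A₁ → s ∉ A₂ → Comparable w₁ u₁ A₁ w₂ u₂ A₂
      nest-beyonds s (beyond c₁ br₁ tr₁ q∈B₁ cov₁) (beyond c₂ br₂ tr₂ q∈B₂ cov₂) s₁ s₂ with view s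
      ... | copy d v with not-injective (uncovered (not c₁) d cov₁ s₁) | not-injective (uncovered (not c₂) d cov₂ s₂)
      ... | refl | refl = lift-comparable tr₁ tr₂ (λ v _ → cov₂ v) (λ v _ → cov₁ v)
                            (nestH q v br₁ br₂ q∈B₁ q∈B₂ (s₁ ∘ trace⁺ tr₁ v) (s₂ ∘ trace⁺ tr₂ v))

      nest-shapes : ∀ {k₁ k₂ w₁ u₁ A₁ w₂ u₂ A₂} r s → Shape k₁ w₁ u₁ A₁ → Shape k₂ w₂ u₂ A₂ →
        r ∈ A₁ → r ∈ A₂ → s ∉ A₁ → s ∉ A₂ → Comparable w₁ u₁ A₁ w₂ u₂ A₂
      nest-shapes r s σ₁@(bridge _ _ _)     σ₂@(bridge _ _ _)     r₁ r₂ s₁ s₂ = nest-bridges r σ₁ σ₂ r₁ r₂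
      nest-shapes r s σ₁@(bridge _ _ _)     σ₂@(within _ _ _ _ _) r₁ r₂ s₁ s₂ = inj₂ (inj₂ (nest-bridge-within r σ₁ σ₂ r₁ r₂))
      nest-shapes r s σ₁@(bridge _ _ _)     σ₂@(beyond _ _ _ _ _) r₁ r₂ s₁ s₂ = inj₂ (inj₁ (nest-bridge-beyond s σ₁ σ₂ s₁ s₂))
      nest-shapes r s σ₁@(within _ _ _ _ _) σ₂@(bridge _ _ _)     r₁ r₂ s₁ s₂ = inj₂ (inj₁ (nest-bridge-within r σ₂ σ₁ r₂ r₁))
      nest-shapes r s σ₁@(within _ _ _ _ _) σ₂@(within _ _ _ _ _) r₁ r₂ s₁ s₂ = nest-withins r σ₁ σ₂ r₁ r₂
      nest-shapes r s σ₁@(within _ _ _ _ _) σ₂@(beyond _ _ _ _ _) r₁ r₂ s₁ s₂ =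
        inj₂ (inj₁ (nest-within-beyond r s σ₁ σ₂ r₁ r₂ s₁ s₂))
      nest-shapes r s σ₁@(beyond _ _ _ _ _) σ₂@(bridge _ _ _)     r₁ r₂ s₁ s₂ = inj₂ (inj₂ (nest-bridge-beyond s σ₂ σ₁ s₂ s₁))
      nest-shapes r s σ₁@(beyond _ _ _ _ _) σ₂@(within _ _ _ _ _) r₁ r₂ s₁ s₂ =
        inj₂ (inj₂ (nest-within-beyond r s σ₂ σ₁ r₂ r₁ s₂ s₁))
      nest-shapes r s σ₁@(beyond _ _ _ _ _) σ₂@(beyond _ _ _ _ _) r₁ r₂ s₁ s₂ = nest-beyonds s σ₁ σ₂ s₁ s₂

      nesting-mirror : Nesting T
      nesting-mirror r s br₁ br₂ = nest-shapes r s (proj₂ (classify br₁)) (proj₂ (classify br₂))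

      -- Within-branches of equal size above a quarter of T meet in H (pigeonhole), so Nesting
      -- for H and equal size put them on the same edge of H: the identity or the swap carries
      -- one to the other.
      withins-aut : ∀ {w₁ u₁ A₁ w₂ u₂ A₂} → Shape below w₁ u₁ A₁ → Shape below w₂ u₂ A₂ →
        ∣ A₁ ∣ ≡ ∣ A₂ ∣ → N + N < 4 * ∣ A₁ ∣ → AutCarrying T A₁ u₁ A₂ u₂
      withins-aut (within c₁ {B = B₁} {A₁} br₁ tr₁ q∉B₁ in₁) (within c₂ {B = B₂} br₂ tr₂ q∉B₂ in₂) sz large
        with pigeonhole B₁ B₂ (subst₂ (λ k l → N < k + l) (size-trace in₁ tr₁) (trans sz (size-trace in₂ tr₂))
                                (more-than-quarter {m = ∣ A₁ ∣} large))
      ... | x , x∈B₁ , x∈B₂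
        with comparable-same-size (nestH x q br₁ br₂ x∈B₁ x∈B₂ q∉B₁ q∉B₂) (traces-equal-size in₁ tr₁ in₂ tr₂ sz)
      ... | refl , refl with ⊆-antisym (branch-unique br₁ br₂) (branch-unique br₂ br₁)
      ... | refl = copies-carry in₁ tr₁ in₂ tr₂

      module _ (isoH : AvoidingIso H) where

        -- Within-branches of equal size avoid q in H, so AvoidingIso for H applies.
        withins-iso : ∀ {w₁ u₁ A₁ w₂ u₂ A₂} → Shape below w₁ u₁ A₁ → Shape below w₂ u₂ A₂ →
          ∣ A₁ ∣ ≡ ∣ A₂ ∣ → RootedIso T A₁ u₁ A₂ u₂
        withins-iso (within c₁ br₁ tr₁ q∉B₁ in₁) (within c₂ br₂ tr₂ q∉B₂ in₂) sz =
          lift-rooted-iso in₁ tr₁ in₂ tr₂ (isoH q br₁ br₂ q∉B₁ q∉B₂ (traces-equal-size in₁ tr₁ in₂ tr₂ sz))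

        -- Two beyond-branches missing s lie over the same copy and contain the other copy of q;
        -- by Nesting for T and equal size they are the same branch.
        avoiding-iso-shapes : ∀ {k w₁ u₁ A₁ w₂ u₂ A₂} s → IsBranch T w₁ u₁ A₁ → IsBranch T w₂ u₂ A₂ →
          Shape k w₁ u₁ A₁ → Shape k w₂ u₂ A₂ → s ∉ A₁ → s ∉ A₂ → ∣ A₁ ∣ ≡ ∣ A₂ ∣ → RootedIso T A₁ u₁ A₂ u₂
        avoiding-iso-shapes s _ _ σ₁@(bridge _ _ _) σ₂ _ _ _ = aut⇒rootedIso (bridges-aut σ₁ σ₂)
        avoiding-iso-shapes s _ _ σ₁@(within _ _ _ _ _) σ₂ _ _ sz = withins-iso σ₁ σ₂ sz
        avoiding-iso-shapes s br₁ br₂ (beyond c₁ _ _ _ cov₁) (beyond c₂ _ _ _ cov₂) s₁ s₂ sz with view s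
        ... | copy d v with not-injective (uncovered (not c₁) d cov₁ s₁) | not-injective (uncovered (not c₂) d cov₂ s₂)
        ... | refl | refl = aut⇒rootedIso (same-edge-carried
              (comparable-same-size (nesting-mirror (emb (not d) q) (emb d v) br₁ br₂ (cov₁ q) (cov₂ q) s₁ s₂) sz)
              br₁ br₂)

        avoiding-iso-mirror : AvoidingIso T
        avoiding-iso-mirror s br₁ br₂ s₁ s₂ sz =
          let _ , σ₁ , σ₂ = classify-equal br₁ br₂ sz in avoiding-iso-shapes s br₁ br₂ σ₁ σ₂ s₁ s₂ sz

        -- Lemma 7.4 (a) and (b) for T, shape by shape; beyond-branches exceed half of T.
        half-iso : ∀ {k w₁ u₁ A₁ w₂ u₂ A₂} → Shape k w₁ u₁ A₁ → Shape k w₂ u₂ A₂ →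
          ∣ A₁ ∣ ≡ ∣ A₂ ∣ → 2 * ∣ A₁ ∣ ≤ N + N → RootedIso T A₁ u₁ A₂ u₂
        half-iso σ₁@(bridge _ _ _)     σ₂ _  _     = aut⇒rootedIso (bridges-aut σ₁ σ₂)
        half-iso σ₁@(within _ _ _ _ _) σ₂ sz _     = withins-iso σ₁ σ₂ sz
        half-iso σ₁@(beyond _ _ _ _ _) _  _  small = ⊥-elim (too-large (shape-size σ₁) small)

        half-aut : ∀ {k w₁ u₁ A₁ w₂ u₂ A₂} → Shape k w₁ u₁ A₁ → Shape k w₂ u₂ A₂ →
          ∣ A₁ ∣ ≡ ∣ A₂ ∣ → N + N < 4 * ∣ A₁ ∣ → 2 * ∣ A₁ ∣ ≤ N + N → AutCarrying T A₁ u₁ A₂ u₂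
        half-aut σ₁@(bridge _ _ _)     σ₂ _  _     _     = bridges-aut σ₁ σ₂
        half-aut σ₁@(within _ _ _ _ _) σ₂ sz large _     = withins-aut σ₁ σ₂ sz large
        half-aut σ₁@(beyond _ _ _ _ _) _  _  _     small = ⊥-elim (too-large (shape-size σ₁) small)

        symmetry-mirror : BranchSymmetry T
        symmetry-mirror _ _ _ _ _ _ br₁ br₂ =
            (λ sz small → let _ , σ₁ , σ₂ = classify-equal br₁ br₂ sz in half-iso σ₁ σ₂ sz small)
          , (λ sz large small → let _ , σ₁ , σ₂ = classify-equal br₁ br₂ sz in half-aut σ₁ σ₂ sz large small)

no-single-branch : ∀ {w u A} → IsBranch single w u A → ⊥
no-single-branch (() , _)

invariants : ∀ {n G} → Mirrored n G → Connected G × Nesting G × AvoidingIso G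
invariants base = (λ { zero zero → ε })
                , (λ _ _ br → ⊥-elim (no-single-branch br))
                , (λ _ br → ⊥-elim (no-single-branch br))
invariants (step {G = H} m q) =
  let conH , nestH , isoH = invariants m
      open Mirror H q
      open Classification conH
  in mirror-connected conH , nesting-mirror nestH , avoiding-iso-mirror nestH isoH

mirrored-symmetry : ∀ {n G} → Mirrored n G → BranchSymmetry G
mirrored-symmetry base _ _ _ _ _ _ br = ⊥-elim (no-single-branch br)
mirrored-symmetry (step {G = H} m q) =
  let conH , nestH , isoH = invariants m
  in Mirror.Classification.symmetry-mirror H q conH nestH isoH

lemma7p4 : ∀ {n} (T : Graph n) → RBM T →
    ∀ (w₁ u₁ w₂ u₂ : Fin n) (A₁ A₂ : Subset n) →
    IsBranch T w₁ u₁ A₁ → IsBranch T w₂ u₂ A₂ →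
    (∣ A₁ ∣ ≡ ∣ A₂ ∣ → 2 * ∣ A₁ ∣ ≤ n → RootedIso T A₁ u₁ A₂ u₂)
    × (∣ A₁ ∣ ≡ ∣ A₂ ∣ → n < 4 * ∣ A₁ ∣ → 2 * ∣ A₁ ∣ ≤ n → AutCarrying T A₁ u₁ A₂ u₂)
lemma7p4 T (G , mirrored , σ , σ-adj) = Transport.transport-symmetry G T σ σ-adj (mirrored-symmetry mirrored)
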